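{- For every formula $\varphi$ of propositional linear temporal logic, $\mathrm{LTL} \models \neg \Box (\varphi\leftrightarrow\bigcirc\diamondsuit\Box\neg\varphi)$.
   Context: Propositional linear temporal logic (LTL) over a set $\mathbf{V}$ of propositional constants, with formulas built from $\mathbf{V}$, $\mathbf{false}$, $\rightarrow$, the "next" operator $\bigcirc$ and the "always" operator $\Box$; $\diamondsuit\varphi$ ("sometime") abbreviates $\neg\Box\neg\varphi$. A temporal (Kripke) structure is an infinite sequence $\mathcal{K}=(\eta_0,\eta_1,\dots)$ of valuations $\eta_i:\mathbf{V}\to\{\mathfrak{ff},\mathfrak{tt}\}$, with $\mathcal{K}_i(v)=\eta_i(v)$, classical clauses for the connectives, $\mathcal{K}_i(\bigcirc\varphi)=\mathcal{K}_{i+1}(\varphi)$, and $\mathcal{K}_i(\Box\varphi)=\mathfrak{tt}$ iff $\mathcal{K}_j(\varphi)=\mathfrak{tt}$ for all $j\ge i$. $\mathrm{LTL}\models\varphi$ means $\mathcal{K}_i(\varphi)=\mathfrak{tt}$ for every temporal structure $\mathcal{K}$ and every $i\in\mathbb{N}$; equivalently, $\neg\varphi$ is not satisfiable. -}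

module Defs where

open import Data.Nat using (ℕ; suc; _≤_)
open import Data.Bool using (Bool; true; false)
open import Data.Empty using (⊥)
open import Relation.Binary.PropositionalEquality using (_≡_)

data Formula (V : Set) : Set where
  var   : V → Formula V
  ff    : Formula V
  _⇒_   : Formula V → Formula V → Formula V
  ○_    : Formula V → Formula V
  □_    : Formula V → Formula V

infixr 5 _⇒_
infix 4 _⇔_
infixr 6 _∧ᶠ_
infix 8 ○_ □_ ¬ᶠ_ ◇_

¬ᶠ_ : ∀ {V} → Formula V → Formula V
¬ᶠ φ = φ ⇒ ff

_∧ᶠ_ : ∀ {V} → Formula V → Formula V → Formula V
φ ∧ᶠ ψ = ¬ᶠ (φ ⇒ ¬ᶠ ψ)

_⇔_ : ∀ {V} → Formula V → Formula V → Formula V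
φ ⇔ ψ = (φ ⇒ ψ) ∧ᶠ (ψ ⇒ φ)

◇_ : ∀ {V} → Formula V → Formula V
◇ φ = ¬ᶠ □ (¬ᶠ φ)

TemporalStructure : Set → Set
TemporalStructure V = ℕ → V → Bool

-- K_i(φ) = tt, rendered as a proposition
_,_⊨_ : ∀ {V} → TemporalStructure V → ℕ → Formula V → Set
K , i ⊨ var v   = K i v ≡ true
K , i ⊨ ff      = ⊥
K , i ⊨ (φ ⇒ ψ) = K , i ⊨ φ → K , i ⊨ ψ
K , i ⊨ (○ φ)   = K , suc i ⊨ φ
K , i ⊨ (□ φ)   = ∀ j → i ≤ j → K , j ⊨ φ

LTL⊨ : ∀ {V} → Formula V → Set
LTL⊨ {V} φ = (K : TemporalStructure V) (i : ℕ) → K , i ⊨ φ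

module Submission where

-- Suppose the biconditional holds at every state j ≥ i.  First, □ ¬φ holds
-- at no state k ≥ i: it would make ○ ◇ □ ¬φ true at k, hence φ true at k,
-- while □ ¬φ itself says φ is false at k.  Consequently □ ¬ □ ¬φ holds from
-- i + 1 on, so ○ ◇ □ ¬φ fails at every j ≥ i, and by the biconditional φ
-- fails at every j ≥ i, i.e. □ ¬φ holds at i — contradicting the first step.
--
-- The argument reads the biconditional classically, in both directions.
-- Constructively this is justified because satisfaction of every formula is
-- ¬¬-stable (valuations are Boolean), which is proved first; from it we get
-- the two projections of ⇔.

open import Defs
open import Data.Nat using (suc; _≤_)
open import Data.Nat.Properties using (≤-refl; ≤-trans; n≤1+n)
open import Data.Bool using (true)
open import Data.Bool.Properties using (_≟_)
open import Data.Empty using (⊥-elim)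
open import Relation.Nullary.Negation using (¬_; Stable)
open import Relation.Nullary.Decidable using (decidable-stable)

module _ {V : Set} (K : TemporalStructure V) where

  -- Satisfaction is ¬¬-stable: atoms are decided by a Boolean valuation and
  -- every connective preserves stability.
  ⊨-stable : ∀ i (φ : Formula V) → Stable (K , i ⊨ φ)
  ⊨-stable i (var v)   = decidable-stable (K i v ≟ true)
  ⊨-stable i ff        ¬¬⊥ = ¬¬⊥ (λ x → x)
  ⊨-stable i (φ ⇒ ψ)   ¬¬f a = ⊨-stable i ψ (λ ¬b → ¬¬f (λ f → ¬b (f a)))
  ⊨-stable i (○ φ)     = ⊨-stable (suc i) φ
  ⊨-stable i (□ φ)     ¬¬b j i≤j = ⊨-stable j φ (λ ¬a → ¬¬b (λ b → ¬a (b j i≤j)))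

  ∧-proj₁ : ∀ {i} (φ ψ : Formula V) → K , i ⊨ (φ ∧ᶠ ψ) → K , i ⊨ φ
  ∧-proj₁ {i} φ ψ φ∧ψ = ⊨-stable i φ (λ ¬a → φ∧ψ (λ a → ⊥-elim (¬a a)))

  ∧-proj₂ : ∀ {i} (φ ψ : Formula V) → K , i ⊨ (φ ∧ᶠ ψ) → K , i ⊨ ψ
  ∧-proj₂ {i} φ ψ φ∧ψ = ⊨-stable i ψ (λ ¬b → φ∧ψ (λ _ → ¬b))

  ⇔-to : ∀ {i} (φ ψ : Formula V) → K , i ⊨ (φ ⇔ ψ) → K , i ⊨ φ → K , i ⊨ ψ
  ⇔-to φ ψ = ∧-proj₁ (φ ⇒ ψ) (ψ ⇒ φ)

  ⇔-from : ∀ {i} (φ ψ : Formula V) → K , i ⊨ (φ ⇔ ψ) → K , i ⊨ ψ → K , i ⊨ φ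
  ⇔-from φ ψ = ∧-proj₂ (φ ⇒ ψ) (ψ ⇒ φ)

  □-persist : ∀ {k l} (φ : Formula V) → k ≤ l → K , k ⊨ (□ φ) → K , l ⊨ (□ φ)
  □-persist φ k≤l □φ m l≤m = □φ m (≤-trans k≤l l≤m)

  □⇒○◇□ : ∀ {k} (φ : Formula V) → K , k ⊨ (□ φ) → K , k ⊨ (○ ◇ □ φ)
  □⇒○◇□ {k} φ □φ □¬□φ = □¬□φ (suc k) ≤-refl (□-persist φ (n≤1+n k) □φ)

  module SelfReference {i} (φ : Formula V)
         (fix : K , i ⊨ (□ (φ ⇔ ○ ◇ □ (¬ᶠ φ)))) where

    -- From i on, □ ¬φ never holds: it would give ○ ◇ □ ¬φ, hence φ, now.
    never-always-false : ∀ k → i ≤ k → ¬ (K , k ⊨ (□ (¬ᶠ φ)))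
    never-always-false k i≤k □¬φ =
      □¬φ k ≤-refl (⇔-from φ (○ ◇ □ (¬ᶠ φ)) (fix k i≤k) (□⇒○◇□ (¬ᶠ φ) □¬φ))

    -- Yet φ fails at every j ≥ i: φ would give ○ ◇ □ ¬φ at j, whereas
    -- □ ¬φ fails at every state after j.
    always-false : K , i ⊨ (□ (¬ᶠ φ))
    always-false j i≤j φj =
      ⇔-to φ (○ ◇ □ (¬ᶠ φ)) (fix j i≤j) φj
        (λ l j+1≤l → never-always-false l (≤-trans i≤j (≤-trans (n≤1+n j) j+1≤l)))

theorem4p2 : {V : Set} (φ : Formula V) → LTL⊨ (¬ᶠ □ (φ ⇔ ○ ◇ □ (¬ᶠ φ)))
theorem4p2 φ K i fix = never-always-false i ≤-refl always-false
  where open SelfReference K φ fix
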